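{- Let $U$ be a relation scheme with $n\ge 3$ attributes and truth lattices $L_A$ ($A\in U$), and let $g$ be a schema interpretation. Then $g$ is a $\wedge$-homomorphism if and only if for every $L\in\mathrm{Sb}(L_U)$, the family $g(L)=\{g(x):x\in L\}$ is a closure system over $U$.
   Context: Each attribute $A$ of $U=\{A_1,\dots,A_n\}$ has a finite lattice $L_A$ with bottom $0_A$ and top $1_A$; $L_U=\prod_{A\in U}L_A$ with componentwise order. $\mathrm{Sb}(L_U)$ is the set of subsets $L\subseteq L_U$ containing the top of $L_U$ and closed under binary meets of $L_U$. An attribute interpretation of $A$ is an increasing map $h_A:L_A\to\{0,1\}$ with $h_A(0_A)=0$, $h_A(1_A)=1$; a schema interpretation is $g(\langle x_1,\dots,x_n\rangle)=\langle h_{A_1}(x_1),\dots,h_{A_n}(x_n)\rangle\in\{0,1\}^n$, where $\{0,1\}^n$ has the componentwise order and vectors are identified with subsets of $U$. $g$ is a $\wedge$-homomorphism if $g(x\wedge y)=g(x)\wedge g(y)$ for all $x,y\in L_U$. A closure system over $U$ is a family of subsets of $U$ containing $U$ and closed under intersection. -}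

module Defs where

open import Level using (0ℓ)
open import Data.Nat using (ℕ)
open import Data.Fin using (Fin)
open import Data.Bool using (Bool; true; false) renaming (_≤_ to _≤ᵇ_)
open import Data.List using (List)
open import Data.List.Relation.Unary.Any using (Any)
open import Data.Vec using (tabulate)
open import Data.Fin.Subset using (Subset; _∩_) renaming (⊤ to fullSet)
open import Data.Product using (Σ; _×_)
open import Relation.Unary using (Pred)
open import Relation.Binary.PropositionalEquality using (_≡_)
open import Relation.Binary.Lattice.Bundles using (BoundedLattice)

record FiniteLattice : Set₁ where
  field
    bLattice : BoundedLattice 0ℓ 0ℓ 0ℓ
  open BoundedLattice bLattice public
  field
    elems    : List Carrier
    complete : ∀ x → Any (x ≈_) elems

open FiniteLattice using () renaming (Carrier to ∣_∣)

-- A relation scheme U = {A_1,...,A_n} with truth lattices L_A, given as a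
-- family of finite lattices indexed by the attributes Fin n.
Scheme : ℕ → Set₁
Scheme n = Fin n → FiniteLattice

LU : ∀ {n} → Scheme n → Set
LU {n} Ls = (i : Fin n) → ∣ Ls i ∣

meetU : ∀ {n} (Ls : Scheme n) → LU Ls → LU Ls → LU Ls
meetU Ls x y i = FiniteLattice._∧_ (Ls i) (x i) (y i)

topU : ∀ {n} (Ls : Scheme n) → LU Ls
topU Ls i = FiniteLattice.⊤ (Ls i)

record InSb {n} (Ls : Scheme n) (L : Pred (LU Ls) 0ℓ) : Set where
  field
    hasTop     : L (topU Ls)
    meetClosed : ∀ {x y} → L x → L y → L (meetU Ls x y)

record AttrInterp (LA : FiniteLattice) : Set where
  open FiniteLattice LA
  field
    h       : Carrier → Bool
    mono    : ∀ {x y} → x ≤ y → h x ≤ᵇ h y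
    h-bot   : h ⊥ ≡ false
    h-top   : h ⊤ ≡ true

schemaInterp : ∀ {n} {Ls : Scheme n} → ((i : Fin n) → AttrInterp (Ls i)) →
               LU Ls → Subset n
schemaInterp hs x = tabulate (λ i → AttrInterp.h (hs i) (x i))

IsMeetHom : ∀ {n} (Ls : Scheme n) → (LU Ls → Subset n) → Set
IsMeetHom Ls g = ∀ x y → g (meetU Ls x y) ≡ g x ∩ g y

image : ∀ {n} {Ls : Scheme n} → (LU Ls → Subset n) → Pred (LU Ls) 0ℓ →
        Pred (Subset n) 0ℓ
image g L S = Σ _ (λ x → L x × g x ≡ S)

-- A closure system over U: contains U and is closed under intersection
-- (for a finite family of subsets, closure under binary intersection
-- together with containing U is closure under arbitrary intersections).
record IsClosureSystem {n} (F : Pred (Subset n) 0ℓ) : Set where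
  field
    hasFull      : F fullSet
    interClosed  : ∀ {S T} → F S → F T → F (S ∩ T)

module Submission where

-- (⇒) If g preserves binary meets, the image of any L ∈ Sb(L_U) is closed
-- under intersection (g x ∩ g y = g (x ∧ y) with x ∧ y ∈ L) and contains
-- U = g(1), since every attribute interpretation sends 1_A to 1.
--
-- (⇐) Monotonicity already gives h(a ∧ b) ≤ h(a) ∧ h(b) coordinatewise, so
-- it suffices to show h_i(a) = h_i(b) = 1 ⇒ h_i(a ∧ b) = 1 at each attribute i.
-- Using n ≥ 3, choose attributes j, k different from i and from each other,
-- and consider x = (a at i, 1 at j, 0 elsewhere), y = (b at i, 0 at j,
-- 1 elsewhere).  The family L of all z with "z_k = 1 or z_i ≤ a" and
-- "z_j = 1 or z_i ≤ b" lies in Sb(L_U) and contains x and y.  Since g(L) is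
-- a closure system, g x ∩ g y = g z for some z ∈ L; this set misses j and k,
-- so z_j, z_k ≠ 1, hence z_i ≤ a ∧ b, and h_i(a ∧ b) ≥ h_i(z_i) = 1.

open import Defs
open import Level using (0ℓ)
open import Data.Nat using (ℕ; _≥_; s≤s; z≤n)
import Data.Nat as ℕ
open import Data.Fin using (Fin; zero; suc; _≟_)
open import Relation.Unary using (Pred)
open import Function.Bundles using (_⇔_; mk⇔)
open import Data.Bool using (Bool; true; false; _∧_; b≤b)
open import Data.Bool.Properties using (∧-zeroʳ)
open import Data.Vec using (Vec; lookup; tabulate)
open import Data.Vec.Properties
  using (lookup-zipWith; lookup-replicate; lookup∘tabulate; tabulate∘lookup; tabulate-cong)
open import Data.Fin.Subset using (Subset; _∩_) renaming (⊤ to fullSet)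
open import Data.Product using (Σ; _×_; _,_)
open import Data.Sum using (_⊎_; inj₁; inj₂)
open import Relation.Nullary using (¬_; yes; no; contradiction)
open import Relation.Binary.PropositionalEquality
  using (_≡_; _≢_; refl; sym; trans; cong; cong₂; module ≡-Reasoning)

open FiniteLattice using () renaming (Carrier to ∣_∣)

lookup-ext : ∀ {A : Set} {n} (u v : Vec A n) → (∀ i → lookup u i ≡ lookup v i) → u ≡ v
lookup-ext u v same =
  trans (sym (tabulate∘lookup u)) (trans (tabulate-cong same) (tabulate∘lookup v))

tabulate-∩ : ∀ {n} (f f′ : Fin n → Bool) →
             tabulate f ∩ tabulate f′ ≡ tabulate (λ i → f i ∧ f′ i)
tabulate-∩ f f′ = lookup-ext _ _ λ i →
  trans (lookup-zipWith _∧_ i (tabulate f) (tabulate f′))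
        (trans (cong₂ _∧_ (lookup∘tabulate f i) (lookup∘tabulate f′ i))
               (sym (lookup∘tabulate _ i)))

tabulate-true : ∀ {n} (f : Fin n → Bool) → (∀ i → f i ≡ true) → tabulate f ≡ fullSet
tabulate-true f allTrue = lookup-ext _ _ λ i →
  trans (lookup∘tabulate f i) (trans (allTrue i) (sym (lookup-replicate i true)))

module AttrFacts {LA : FiniteLattice} (φ : AttrInterp LA) where
  open FiniteLattice LA using (_≤_; ⊤; x∧y≤x; x∧y≤y) renaming (_∧_ to _⊓_)
  open AttrInterp φ using (h; mono; h-top)

  true-upward : ∀ {a b} → a ≤ b → h a ≡ true → h b ≡ true
  true-upward {a} {b} a≤b ha with h a | h b | mono a≤b
  true-upward a≤b refl | true | _ | b≤b = refl

  false⇒¬top : ∀ {a} → h a ≡ false → ¬ (⊤ ≤ a)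
  false⇒¬top ha ⊤≤a with trans (sym ha) (true-upward ⊤≤a h-top)
  ... | ()

  -- By monotonicity h(a ⊓ b) ≤ h a ∧ h b, so h preserves the meet of a
  -- and b as soon as h a = h b = true forces h (a ⊓ b) = true.
  preserves-meet : ∀ a b → (h a ≡ true → h b ≡ true → h (a ⊓ b) ≡ true) →
                   h (a ⊓ b) ≡ h a ∧ h b
  preserves-meet a b both with h a in ha | h b in hb
  ... | true | true = both refl refl
  ... | false | _ with h (a ⊓ b) in hab
  ...   | false = refl
  ...   | true = sym (trans (sym ha) (true-upward (x∧y≤x a b) hab))
  preserves-meet a b both | true | false with h (a ⊓ b) in hab
  ...   | false = refl
  ...   | true = sym (trans (sym hb) (true-upward (x∧y≤y a b) hab))

module SbFacts {n} (Ls : Scheme n) where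
  module Lat (l : Fin n) = FiniteLattice (Ls l)

  ×-Sb : ∀ {L M : Pred (LU Ls) 0ℓ} → InSb Ls L → InSb Ls M → InSb Ls (λ z → L z × M z)
  ×-Sb sbL sbM = record
    { hasTop     = InSb.hasTop sbL , InSb.hasTop sbM
    ; meetClosed = λ { (Lx , Mx) (Ly , My) →
        InSb.meetClosed sbL Lx Ly , InSb.meetClosed sbM Mx My }
    }

  Guard : (k i : Fin n) → ∣ Ls i ∣ → Pred (LU Ls) 0ℓ
  Guard k i a z = Lat._≤_ k (Lat.⊤ k) (z k) ⊎ Lat._≤_ i (z i) a

  Guard-Sb : ∀ k i a → InSb Ls (Guard k i a)
  Guard-Sb k i a = record { hasTop = inj₁ (Lat.refl k) ; meetClosed = meet }
    where
    meet : ∀ {x y} → Guard k i a x → Guard k i a y → Guard k i a (meetU Ls x y)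
    meet (inj₁ ⊤≤x) (inj₁ ⊤≤y) = inj₁ (Lat.∧-greatest k ⊤≤x ⊤≤y)
    meet {x} {y} (inj₂ x≤a) _ = inj₂ (Lat.trans i (Lat.x∧y≤x i (x i) (y i)) x≤a)
    meet {x} {y} (inj₁ _) (inj₂ y≤a) = inj₂ (Lat.trans i (Lat.x∧y≤y i (x i) (y i)) y≤a)

module SchemaFacts {n} {Ls : Scheme n} (hs : (i : Fin n) → AttrInterp (Ls i)) where
  g : LU Ls → Subset n
  g = schemaInterp hs

  H : (l : Fin n) → ∣ Ls l ∣ → Bool
  H l = AttrInterp.h (hs l)

  g-top : g (topU Ls) ≡ fullSet
  g-top = tabulate-true _ (λ l → AttrInterp.h-top (hs l))

  g-∩ : ∀ x y → g x ∩ g y ≡ tabulate (λ l → H l (x l) ∧ H l (y l))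
  g-∩ x y = tabulate-∩ _ _

  coord-∩ : ∀ {x y z} → g z ≡ g x ∩ g y → ∀ l → H l (z l) ≡ H l (x l) ∧ H l (y l)
  coord-∩ {x} {y} {z} eq l = begin
    H l (z l)                         ≡⟨ sym (lookup∘tabulate _ l) ⟩
    lookup (g z) l                    ≡⟨ cong (λ v → lookup v l) (trans eq (g-∩ x y)) ⟩
    lookup (tabulate (λ l → H l (x l) ∧ H l (y l))) l ≡⟨ lookup∘tabulate _ l ⟩
    H l (x l) ∧ H l (y l)             ∎
    where open ≡-Reasoning

  meetHom-coordinatewise :
    (∀ x y l → H l (FiniteLattice._∧_ (Ls l) (x l) (y l)) ≡ H l (x l) ∧ H l (y l)) →
    IsMeetHom Ls g
  meetHom-coordinatewise pres x y = trans (tabulate-cong (pres x y)) (sym (g-∩ x y))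

image-closure : ∀ {n} {Ls : Scheme n} (g : LU Ls → Subset n) →
                IsMeetHom Ls g → g (topU Ls) ≡ fullSet →
                ∀ {L} → InSb Ls L → IsClosureSystem (image {Ls = Ls} g L)
image-closure {Ls = Ls} g hom g-top sb = record
  { hasFull     = topU Ls , InSb.hasTop sb , g-top
  ; interClosed = λ { (x , Lx , refl) (y , Ly , refl) →
      meetU Ls x y , InSb.meetClosed sb Lx Ly , hom x y }
  }

override : ∀ {n} (Ls : Scheme n) → LU Ls → (i : Fin n) → ∣ Ls i ∣ → LU Ls
override Ls z i a l with i ≟ l
... | yes refl = a
... | no _ = z l

override-same : ∀ {n} {Ls : Scheme n} (z : LU Ls) i a → override Ls z i a i ≡ a
override-same z i a with i ≟ i
... | yes refl = refl
... | no i≢i = contradiction refl i≢i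

override-other : ∀ {n} {Ls : Scheme n} (z : LU Ls) {i l} a → i ≢ l → override Ls z i a l ≡ z l
override-other z {i} {l} a i≢l with i ≟ l
... | yes i≡l = contradiction i≡l i≢l
... | no _ = refl

twoOthers : ∀ {m} (i : Fin (ℕ.suc (ℕ.suc (ℕ.suc m)))) →
  Σ (Fin _) λ j → Σ (Fin _) λ k → (i ≢ j) × (i ≢ k) × (j ≢ k)
twoOthers zero = suc zero , suc (suc zero) , (λ ()) , (λ ()) , (λ ())
twoOthers (suc zero) = zero , suc (suc zero) , (λ ()) , (λ ()) , (λ ())
twoOthers (suc (suc i)) = zero , suc zero , (λ ()) , (λ ()) , (λ ())

module Witness {n} (Ls : Scheme n) (hs : (i : Fin n) → AttrInterp (Ls i))
               (i j k : Fin n) (i≢j : i ≢ j) (i≢k : i ≢ k) (j≢k : j ≢ k)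
               (a b : ∣ Ls i ∣) where
  open SbFacts Ls
  open SchemaFacts hs

  x y : LU Ls
  x = override Ls (override Ls (λ l → Lat.⊥ l) j (Lat.⊤ j)) i a
  y = override Ls (override Ls (topU Ls) j (Lat.⊥ j)) i b

  xi : x i ≡ a
  xi = override-same _ i a
  yi : y i ≡ b
  yi = override-same _ i b
  xj : x j ≡ Lat.⊤ j
  xj = trans (override-other _ a i≢j) (override-same _ j _)
  yj : y j ≡ Lat.⊥ j
  yj = trans (override-other _ b i≢j) (override-same _ j _)
  xk : x k ≡ Lat.⊥ k
  xk = trans (override-other _ a i≢k) (override-other _ _ j≢k)
  yk : y k ≡ Lat.⊤ k
  yk = trans (override-other _ b i≢k) (override-other _ _ j≢k)

  ≤-of-≡ : ∀ l {p q : ∣ Ls l ∣} → p ≡ q → Lat._≤_ l p q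
  ≤-of-≡ l refl = Lat.refl l

  L : Pred (LU Ls) 0ℓ
  L z = Guard k i a z × Guard j i b z

  L-Sb : InSb Ls L
  L-Sb = ×-Sb (Guard-Sb k i a) (Guard-Sb j i b)

  x∈L : L x
  x∈L = inj₂ (≤-of-≡ i xi) , inj₁ (≤-of-≡ j (sym xj))

  y∈L : L y
  y∈L = inj₁ (≤-of-≡ k (sym yk)) , inj₂ (≤-of-≡ i yi)

  below : ∀ {k′ c z} → H k′ (z k′) ≡ false → Guard k′ i c z → Lat._≤_ i (z i) c
  below {k′} hz (inj₁ ⊤≤z) = contradiction ⊤≤z (AttrFacts.false⇒¬top (hs k′) hz)
  below hz (inj₂ z≤c) = z≤c

  -- The intersection g x ∩ g y is g z for some z ∈ L; it misses j and k, so
  -- both guards of z give z_i ≤ a ∧ b, while h_i(z_i) = h_i(a) ∧ h_i(b) = 1.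
  meet-true : IsClosureSystem (image {Ls = Ls} g L) →
              H i a ≡ true → H i b ≡ true → H i (Lat._∧_ i a b) ≡ true
  meet-true closed ha hb
    with IsClosureSystem.interClosed closed (x , x∈L , refl) (y , y∈L , refl)
  ... | z , (z-k , z-j) , gz = AttrFacts.true-upward (hs i) z≤a∧b hzi
    where
    hzk : H k (z k) ≡ false
    hzk = trans (coord-∩ gz k)
      (cong₂ _∧_ (trans (cong (H k) xk) (AttrInterp.h-bot (hs k))) (cong (H k) yk))
    hzj : H j (z j) ≡ false
    hzj = trans (coord-∩ gz j)
      (trans (cong₂ _∧_ (cong (H j) xj) (trans (cong (H j) yj) (AttrInterp.h-bot (hs j))))
             (∧-zeroʳ _))
    hzi : H i (z i) ≡ true
    hzi = trans (coord-∩ gz i) (cong₂ _∧_ (trans (cong (H i) xi) ha) (trans (cong (H i) yi) hb))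
    z≤a∧b : Lat._≤_ i (z i) (Lat._∧_ i a b)
    z≤a∧b = Lat.∧-greatest i (below hzk z-k) (below hzj z-j)

theorem1 : (n : ℕ) → n ≥ 3 → (Ls : Scheme n) →
    (hs : (i : Fin n) → AttrInterp (Ls i)) →
    IsMeetHom Ls (schemaInterp hs) ⇔
    ((L : Pred (LU Ls) 0ℓ) → InSb Ls L →
    IsClosureSystem (image {Ls = Ls} (schemaInterp hs) L))
theorem1 (ℕ.suc (ℕ.suc (ℕ.suc m))) (s≤s (s≤s (s≤s z≤n))) Ls hs =
  mk⇔ (λ hom L sb → image-closure g hom g-top sb)
      (λ closed → meetHom-coordinatewise (λ x y l → preserves x y l closed))
  where
  open SchemaFacts hs
  preserves : ∀ (x y : LU Ls) l → (∀ L → InSb Ls L → IsClosureSystem (image {Ls = Ls} g L)) →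
              H l (FiniteLattice._∧_ (Ls l) (x l) (y l)) ≡ H l (x l) ∧ H l (y l)
  preserves x y l closed with twoOthers l
  ... | j , k , l≢j , l≢k , j≢k =
    AttrFacts.preserves-meet (hs l) (x l) (y l) (W.meet-true (closed W.L W.L-Sb))
    where module W = Witness Ls hs l j k l≢j l≢k j≢k (x l) (y l)
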